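{- As $\mathbb{L}$-species, $\mathrm{Prim}' = \mathrm{Cay}^2$. Equivalently, for every $n\ge 0$, the number of primitive Cayley permutations of length $n+1$ equals $\sum_{k=0}^{n}\binom{n}{k}c_k c_{n-k}$, where $c_m$ is the number of Cayley permutations of length $m$.
   Context: A Cayley permutation of length $n$ is a word $w=w_1\cdots w_n$ of positive integers with $\{w_1,\dots,w_n\}=[k]$ for some $k\le n$. It is primitive if $n\ge1$ and $w_i\ne w_{i+1}$ for all $1\le i\le n-1$. An $\mathbb{L}$-species assigns to each finite totally ordered set a finite set of structures, functorially in order-preserving bijections; two $\mathbb{L}$-species are isomorphic (written $=$) iff they have the same number of structures on every $n$-element set. $\mathrm{Cay}$ and $\mathrm{Prim}$ are the $\mathbb{L}$-species of Cayley permutations and of primitive Cayley permutations. The derivative is $F'[\ell]=F[1\oplus\ell]$ ($\ell$ with a new minimum adjoined), and the product is $(F\cdot G)[\ell]=\bigsqcup_{\ell=\ell_1\sqcup\ell_2}F[\ell_1]\times G[\ell_2]$ over ordered pairs of complementary subsets with the induced orders; $F^2=F\cdot F$. -}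

module Defs where

open import Data.Bool using (Bool; true; false; _∧_; not)
open import Data.Nat using (ℕ; zero; suc; _+_; _*_; _∸_; _≤ᵇ_; _≡ᵇ_)
open import Data.Nat.Combinatorics using (_C_)
open import Data.List using (List; []; _∷_; [_]; map; concatMap; length; filterᵇ; upTo; applyUpTo)
open import Data.Bool.ListAction using (all; any)
open import Data.Nat.ListAction using (sum)

oneTo : ℕ → List ℕ
oneTo m = applyUpTo suc m

words : ℕ → ℕ → List (List ℕ)
words zero    m = [ [] ]
words (suc n) m = concatMap (λ a → map (a ∷_) (words n m)) (oneTo m)

elem : ℕ → List ℕ → Bool
elem j w = any (j ≡ᵇ_) w

isCayley : List ℕ → Bool
isCayley w = any (λ k → all (λ x → (1 ≤ᵇ x) ∧ (x ≤ᵇ k)) w ∧ all (λ j → elem j w) (oneTo k))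
                 (upTo (suc (length w)))

noAdjEq : List ℕ → Bool
noAdjEq []           = true
noAdjEq (x ∷ [])     = true
noAdjEq (x ∷ y ∷ w)  = not (x ≡ᵇ y) ∧ noAdjEq (y ∷ w)

nonEmpty : List ℕ → Bool
nonEmpty []      = false
nonEmpty (_ ∷ _) = true

isPrim : List ℕ → Bool
isPrim w = nonEmpty w ∧ isCayley w ∧ noAdjEq w

-- A Cayley permutation of length n has all letters in [1..n], so enumerating
-- words n n finds all of them (each exactly once).
-- c n = number of Cayley permutations of length n
cay : ℕ → ℕ
cay n = length (filterᵇ isCayley (words n n))

prim : ℕ → ℕ
prim n = length (filterᵇ isPrim (words n n))

caySqCount : ℕ → ℕ
caySqCount n = sum (map (λ k → (n C k) * cay k * cay (n ∸ k)) (upTo (suc n)))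

-- Let coverings n s r count the words of length n over s + r letters in which each of r
-- designated letters occurs; splitting on the first letter gives
--   coverings (n+1) s r = r · coverings n (s+1) (r-1) + s · coverings n s r.
-- A Cayley permutation with maximum k is such a word with s = 0 and r = k, so
-- cay n = Σ_k coverings n 0 k. A primitive one of length n+1 has k choices of first letter,
-- after which the letter just written is always an already used one: exactly one used
-- letter is forbidden at each step, which leaves k · coverings n 0 (k-1) words.
-- The recurrence is a Leibniz rule, so for the binomial convolution ⋆ we get
-- coverings · s₁ a ⋆ coverings · s₂ b = coverings · (s₁+s₂) (a+b), and therefore
-- (cay ⋆ cay) n = Σ_{a,b} coverings n 0 (a+b) = Σ_K (K+1) · coverings n 0 K = prim (n+1).
module Submission where

open import Algebra.Bundles using (CommutativeMonoid)
open import Data.Bool using (Bool; true; false; _∧_; _∨_; not; T?)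
open import Data.Bool.ListAction using (all; any)
open import Data.Bool.Properties
  using (∧-assoc; ∧-identityʳ; ∧-zeroʳ; ∧-inverseʳ; ∨-assoc; ∨-identityʳ; T-≡; ∧-commutativeMonoid)
open import Data.Empty using (⊥-elim)
open import Data.List using (List; []; _∷_; map; concatMap; length; filterᵇ; upTo; applyUpTo; _++_)
open import Data.List.Properties using (length-++; filter-++)
open import Data.Nat
open import Data.Nat.Combinatorics using (_C_; nCk+nC[k+1]≡[n+1]C[k+1]; k>n⇒nCk≡0)
open import Data.Nat.ListAction using (sum)
open import Data.Nat.Properties
open import Data.Nat.Tactic.RingSolver using (solve-∀)
open import Data.Product using (Σ; _×_; _,_; proj₁; proj₂)
open import Data.Sum using (inj₁; inj₂)
open import Function using (_∘_; Equivalence)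
open import Relation.Binary.Definitions using (tri<; tri≈; tri>)
open import Relation.Binary.PropositionalEquality
open import Relation.Nullary using (contradiction)
open import Algebra.Properties.CommutativeSemigroup +-commutativeSemigroup using (interchange; x∙yz≈y∙xz)
open import Algebra.Properties.CommutativeSemigroup (CommutativeMonoid.commutativeSemigroup ∧-commutativeMonoid)
  renaming (interchange to ∧-interchange) using ()
open import Defs
open ≡-Reasoning

∑ : ℕ → (ℕ → ℕ) → ℕ
∑ zero    f = 0
∑ (suc n) f = ∑ n f + f n

infix 6.5 ∑
syntax ∑ n (λ i → e) = ∑[ i < n ] e

∑-cong : ∀ {f g} n → (∀ i → i < n → f i ≡ g i) → ∑ n f ≡ ∑ n g
∑-cong zero    eq = refl
∑-cong (suc n) eq = cong₂ _+_ (∑-cong n (λ i i<n → eq i (m<n⇒m<1+n i<n))) (eq n ≤-refl)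

∑-zeros : ∀ {f} n → (∀ i → i < n → f i ≡ 0) → ∑ n f ≡ 0
∑-zeros zero    eq = refl
∑-zeros (suc n) eq = cong₂ _+_ (∑-zeros n (λ i i<n → eq i (m<n⇒m<1+n i<n))) (eq n ≤-refl)

∑-unfoldˡ : ∀ f n → ∑ (suc n) f ≡ f 0 + ∑[ i < n ] f (suc i)
∑-unfoldˡ f zero    = +-comm 0 (f 0)
∑-unfoldˡ f (suc n) = trans (cong (_+ f (suc n)) (∑-unfoldˡ f n)) (+-assoc (f 0) _ _)

∑-distrib-+ : ∀ f g n → ∑[ i < n ] (f i + g i) ≡ ∑ n f + ∑ n g
∑-distrib-+ f g zero    = refl
∑-distrib-+ f g (suc n) =
  trans (cong (_+ (f n + g n)) (∑-distrib-+ f g n)) (interchange (∑ n f) (∑ n g) (f n) (g n))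

∑-*ˡ : ∀ c f n → ∑[ i < n ] (c * f i) ≡ c * ∑ n f
∑-*ˡ c f zero    = sym (*-zeroʳ c)
∑-*ˡ c f (suc n) = trans (cong (_+ c * f n) (∑-*ˡ c f n)) (sym (*-distribˡ-+ c (∑ n f) (f n)))

∑-*ʳ : ∀ c f n → ∑[ i < n ] (f i * c) ≡ ∑ n f * c
∑-*ʳ c f zero    = refl
∑-*ʳ c f (suc n) = trans (cong (_+ f n * c) (∑-*ʳ c f n)) (sym (*-distribʳ-+ c (∑ n f) (f n)))

∑-const : ∀ c n → ∑[ i < n ] c ≡ n * c
∑-const c zero    = refl
∑-const c (suc n) = trans (cong (_+ c) (∑-const c n)) (+-comm (n * c) c)

∑-comm : ∀ (h : ℕ → ℕ → ℕ) m n → ∑[ i < m ] ∑[ j < n ] h i j ≡ ∑[ j < n ] ∑[ i < m ] h i j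
∑-comm h zero    n = sym (∑-zeros n (λ _ _ → refl))
∑-comm h (suc m) n = begin
  ∑[ i < m ] ∑[ j < n ] h i j + ∑[ j < n ] h m j ≡⟨ cong (_+ ∑[ j < n ] h m j) (∑-comm h m n) ⟩
  ∑[ j < n ] ∑[ i < m ] h i j + ∑[ j < n ] h m j ≡⟨ ∑-distrib-+ _ _ n ⟨
  ∑[ j < n ] ∑[ i < suc m ] h i j                ∎

∑-extend : ∀ f {m n} → m ≤ n → (∀ i → m ≤ i → f i ≡ 0) → ∑ m f ≡ ∑ n f
∑-extend f {n = zero}  z≤n   vanish = refl
∑-extend f {m} {suc n} m≤1+n vanish with m≤n⇒m<n∨m≡n m≤1+n
... | inj₂ refl  = refl
... | inj₁ m<1+n = begin
  ∑ m f              ≡⟨ ∑-extend f (s≤s⁻¹ m<1+n) vanish ⟩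
  ∑ n f              ≡⟨ +-identityʳ (∑ n f) ⟨
  ∑ n f + 0          ≡⟨ cong (∑ n f +_) (vanish n (s≤s⁻¹ m<1+n)) ⟨
  ∑ (suc n) f        ∎

sum-applyUpTo : ∀ (f g : ℕ → ℕ) n → sum (map f (applyUpTo g n)) ≡ ∑[ i < n ] f (g i)
sum-applyUpTo f g zero    = refl
sum-applyUpTo f g (suc n) =
  trans (cong (f (g 0) +_) (sum-applyUpTo f (g ∘ suc) n)) (sym (∑-unfoldˡ (f ∘ g) n))

⟦_⟧ : Bool → ℕ
⟦ true  ⟧ = 1
⟦ false ⟧ = 0

⋀ : ℕ → (ℕ → Bool) → Bool
⋀ zero    f = true
⋀ (suc n) f = ⋀ n f ∧ f n

⋁ : ℕ → (ℕ → Bool) → Bool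
⋁ zero    f = false
⋁ (suc n) f = ⋁ n f ∨ f n

infix 6.5 ⋀ ⋁
syntax ⋀ n (λ i → e) = ⋀[ i < n ] e
syntax ⋁ n (λ i → e) = ⋁[ i < n ] e

⋀-unfoldˡ : ∀ f n → ⋀ (suc n) f ≡ f 0 ∧ ⋀[ i < n ] f (suc i)
⋀-unfoldˡ f zero    = sym (∧-identityʳ (f 0))
⋀-unfoldˡ f (suc n) = trans (cong (_∧ f (suc n)) (⋀-unfoldˡ f n)) (∧-assoc (f 0) _ _)

⋁-unfoldˡ : ∀ f n → ⋁ (suc n) f ≡ f 0 ∨ ⋁[ i < n ] f (suc i)
⋁-unfoldˡ f zero    = sym (∨-identityʳ (f 0))
⋁-unfoldˡ f (suc n) = trans (cong (_∨ f (suc n)) (⋁-unfoldˡ f n)) (∨-assoc (f 0) _ _)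

⋀-cong : ∀ {f g} n → (∀ i → i < n → f i ≡ g i) → ⋀ n f ≡ ⋀ n g
⋀-cong zero    eq = refl
⋀-cong (suc n) eq = cong₂ _∧_ (⋀-cong n (λ i i<n → eq i (m<n⇒m<1+n i<n))) (eq n ≤-refl)

⋀-extend : ∀ f {m n} → m ≤ n → (∀ i → m ≤ i → f i ≡ true) → ⋀ m f ≡ ⋀ n f
⋀-extend f {n = zero}  z≤n   trivial = refl
⋀-extend f {m} {suc n} m≤1+n trivial with m≤n⇒m<n∨m≡n m≤1+n
... | inj₂ refl  = refl
... | inj₁ m<1+n = begin
  ⋀ m f              ≡⟨ ⋀-extend f (s≤s⁻¹ m<1+n) trivial ⟩
  ⋀ n f              ≡⟨ ∧-identityʳ (⋀ n f) ⟨
  ⋀ n f ∧ true       ≡⟨ cong (⋀ n f ∧_) (trivial n (s≤s⁻¹ m<1+n)) ⟨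
  ⋀ (suc n) f        ∎

⋀-elim : ∀ f {n i} → ⋀ n f ≡ true → i < n → f i ≡ true
⋀-elim f {suc n} {i} holds i<1+n with ⋀ n f in holds-n | f n in holds-last
⋀-elim f {suc n} {i} holds i<1+n | true | true with m<1+n⇒m<n∨m≡n i<1+n
... | inj₁ i<n  = ⋀-elim f holds-n i<n
... | inj₂ refl = holds-last

⋁-elim : ∀ f n → ⋁ n f ≡ true → Σ ℕ (λ k → k < n × f k ≡ true)
⋁-elim f (suc n) holds with ⋁ n f in holds-n | f n in holds-last
... | true  | _    = let k , k<n , fk = ⋁-elim f n holds-n in k , m<n⇒m<1+n k<n , fk
... | false | true = n , ≤-refl , holds-last

⟦⋁∧⟧ : ∀ f b n → (∀ {k k′} → f k ≡ true → f k′ ≡ true → k ≡ k′) →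
       ⟦ (⋁ n f) ∧ b ⟧ ≡ ∑[ k < n ] ⟦ f k ∧ b ⟧
⟦⋁∧⟧ f b zero    unique = refl
⟦⋁∧⟧ f b (suc n) unique with f n in fn
... | false = begin
  ⟦ (⋁ n f ∨ false) ∧ b ⟧           ≡⟨ cong (λ c → ⟦ c ∧ b ⟧) (∨-identityʳ (⋁ n f)) ⟩
  ⟦ ⋁ n f ∧ b ⟧                     ≡⟨ ⟦⋁∧⟧ f b n unique ⟩
  ∑[ k < n ] ⟦ f k ∧ b ⟧            ≡⟨ +-identityʳ _ ⟨
  ∑[ k < n ] ⟦ f k ∧ b ⟧ + 0        ∎
... | true with ⋁ n f in earlier
...   | true  = let k , k<n , fk = ⋁-elim f n earlier in ⊥-elim (<⇒≢ k<n (unique fk fn))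
...   | false = cong (_+ ⟦ b ⟧) (begin
  0                       ≡⟨ cong (λ c → ⟦ c ∧ b ⟧) earlier ⟨
  ⟦ ⋁ n f ∧ b ⟧           ≡⟨ ⟦⋁∧⟧ f b n unique ⟩
  ∑[ k < n ] ⟦ f k ∧ b ⟧  ∎)

all-applyUpTo : ∀ (q : ℕ → Bool) (g : ℕ → ℕ) n → all q (applyUpTo g n) ≡ ⋀[ i < n ] q (g i)
all-applyUpTo q g zero    = refl
all-applyUpTo q g (suc n) = trans (cong (q (g 0) ∧_) (all-applyUpTo q (g ∘ suc) n)) (sym (⋀-unfoldˡ (q ∘ g) n))

any-applyUpTo : ∀ (q : ℕ → Bool) (g : ℕ → ℕ) n → any q (applyUpTo g n) ≡ ⋁[ i < n ] q (g i)
any-applyUpTo q g zero    = refl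
any-applyUpTo q g (suc n) = trans (cong (q (g 0) ∨_) (any-applyUpTo q (g ∘ suc) n)) (sym (⋁-unfoldˡ (q ∘ g) n))

-- Covering numbers and binomial convolution

coverings : ℕ → ℕ → ℕ → ℕ
coverings zero    s zero    = 1
coverings zero    s (suc r) = 0
coverings (suc n) s r       = r * coverings n (suc s) (pred r) + s * coverings n s r

coverings-vanish : ∀ n s r → n < r → coverings n s r ≡ 0
coverings-vanish zero    s (suc r) _         = refl
coverings-vanish (suc n) s (suc r) (s≤s n<r) = cong₂ _+_
  (trans (cong (suc r *_) (coverings-vanish n (suc s) r n<r)) (*-zeroʳ (suc r)))
  (trans (cong (s *_) (coverings-vanish n s (suc r) (m<n⇒m<1+n n<r))) (*-zeroʳ s))

infixl 7 _⋆_

_⋆_ : (ℕ → ℕ) → (ℕ → ℕ) → ℕ → ℕ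
(f ⋆ g) n = ∑[ k < suc n ] (n C k) * f k * g (n ∸ k)

⋆-cong : ∀ {f f′ g g′} n → (∀ k → k ≤ n → f k ≡ f′ k) → (∀ k → k ≤ n → g k ≡ g′ k) →
         (f ⋆ g) n ≡ (f′ ⋆ g′) n
⋆-cong n f≗f′ g≗g′ = ∑-cong (suc n) (λ k k<1+n →
  cong₂ (λ x y → (n C k) * x * y) (f≗f′ k (s≤s⁻¹ k<1+n)) (g≗g′ (n ∸ k) (m∸n≤m n k)))

⋆-suc : ∀ f g n → (f ⋆ g) (suc n) ≡ ((f ∘ suc) ⋆ g) n + (f ⋆ (g ∘ suc)) n
⋆-suc f g n = begin
  (f ⋆ g) (suc n)
    ≡⟨ ∑-unfoldˡ _ (suc n) ⟩
  first + ∑[ k < suc n ] (suc n C suc k) * f (suc k) * g (n ∸ k)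
    ≡⟨ cong (first +_) (trans (∑-cong (suc n) (λ k _ → pascal k)) (∑-distrib-+ A B (suc n))) ⟩
  first + (((f ∘ suc) ⋆ g) n + (∑ n B + B n))
    ≡⟨ cong (λ t → first + (((f ∘ suc) ⋆ g) n + t)) (trans (cong (∑ n B +_) last-B) (+-identityʳ _)) ⟩
  first + (((f ∘ suc) ⋆ g) n + ∑ n B)
    ≡⟨ x∙yz≈y∙xz first (((f ∘ suc) ⋆ g) n) (∑ n B) ⟩
  ((f ∘ suc) ⋆ g) n + (first + ∑ n B)
    ≡⟨ cong (λ t → ((f ∘ suc) ⋆ g) n + (first + t))
            (∑-cong n (λ k k<n → cong (λ j → (n C suc k) * f (suc k) * g j) (+-∸-assoc 1 k<n))) ⟩
  ((f ∘ suc) ⋆ g) n + (first + ∑[ k < n ] (n C suc k) * f (suc k) * g (suc (n ∸ suc k)))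
    ≡⟨ cong (((f ∘ suc) ⋆ g) n +_) (∑-unfoldˡ _ n) ⟨
  ((f ∘ suc) ⋆ g) n + (f ⋆ (g ∘ suc)) n ∎
  where
  first = (n C 0) * f 0 * g (suc n)
  A B : ℕ → ℕ
  A k = (n C k) * f (suc k) * g (n ∸ k)
  B k = (n C suc k) * f (suc k) * g (n ∸ k)
  pascal : ∀ k → (suc n C suc k) * f (suc k) * g (n ∸ k) ≡ A k + B k
  pascal k = begin
    (suc n C suc k) * f (suc k) * g (n ∸ k)
      ≡⟨ cong (λ c → c * f (suc k) * g (n ∸ k)) (nCk+nC[k+1]≡[n+1]C[k+1] n k) ⟨
    ((n C k) + (n C suc k)) * f (suc k) * g (n ∸ k)
      ≡⟨ cong (_* g (n ∸ k)) (*-distribʳ-+ (f (suc k)) (n C k) (n C suc k)) ⟩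
    ((n C k) * f (suc k) + (n C suc k) * f (suc k)) * g (n ∸ k)
      ≡⟨ *-distribʳ-+ (g (n ∸ k)) ((n C k) * f (suc k)) ((n C suc k) * f (suc k)) ⟩
    A k + B k ∎
  last-B : B n ≡ 0
  last-B rewrite k>n⇒nCk≡0 {n} {suc n} ≤-refl = refl

⋆-linearˡ : ∀ c d f₁ f₂ g n →
            ((λ k → c * f₁ k + d * f₂ k) ⋆ g) n ≡ c * (f₁ ⋆ g) n + d * (f₂ ⋆ g) n
⋆-linearˡ c d f₁ f₂ g n = begin
  ((λ k → c * f₁ k + d * f₂ k) ⋆ g) n
    ≡⟨ ∑-cong (suc n) (λ k _ → distrib (n C k) c d (f₁ k) (f₂ k) (g (n ∸ k))) ⟩
  ∑[ k < suc n ] (c * ((n C k) * f₁ k * g (n ∸ k)) + d * ((n C k) * f₂ k * g (n ∸ k)))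
    ≡⟨ ∑-distrib-+ _ _ (suc n) ⟩
  ∑[ k < suc n ] c * ((n C k) * f₁ k * g (n ∸ k)) + ∑[ k < suc n ] d * ((n C k) * f₂ k * g (n ∸ k))
    ≡⟨ cong₂ _+_ (∑-*ˡ c _ (suc n)) (∑-*ˡ d _ (suc n)) ⟩
  c * (f₁ ⋆ g) n + d * (f₂ ⋆ g) n ∎
  where
  distrib : ∀ b c d x y z → b * (c * x + d * y) * z ≡ c * (b * x * z) + d * (b * y * z)
  distrib = solve-∀

⋆-linearʳ : ∀ c d f g₁ g₂ n →
            (f ⋆ (λ k → c * g₁ k + d * g₂ k)) n ≡ c * (f ⋆ g₁) n + d * (f ⋆ g₂) n
⋆-linearʳ c d f g₁ g₂ n = begin
  (f ⋆ (λ k → c * g₁ k + d * g₂ k)) n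
    ≡⟨ ∑-cong (suc n) (λ k _ → distrib (n C k) c d (f k) (g₁ (n ∸ k)) (g₂ (n ∸ k))) ⟩
  ∑[ k < suc n ] (c * ((n C k) * f k * g₁ (n ∸ k)) + d * ((n C k) * f k * g₂ (n ∸ k)))
    ≡⟨ ∑-distrib-+ _ _ (suc n) ⟩
  ∑[ k < suc n ] c * ((n C k) * f k * g₁ (n ∸ k)) + ∑[ k < suc n ] d * ((n C k) * f k * g₂ (n ∸ k))
    ≡⟨ cong₂ _+_ (∑-*ˡ c _ (suc n)) (∑-*ˡ d _ (suc n)) ⟩
  c * (f ⋆ g₁) n + d * (f ⋆ g₂) n ∎
  where
  distrib : ∀ b c d x y z → b * x * (c * y + d * z) ≡ c * (b * x * y) + d * (b * x * z)
  distrib = solve-∀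

⋆-∑ˡ : ∀ (h : ℕ → ℕ → ℕ) g N n → ((λ k → ∑[ a < N ] h a k) ⋆ g) n ≡ ∑[ a < N ] (h a ⋆ g) n
⋆-∑ˡ h g N n = begin
  ((λ k → ∑[ a < N ] h a k) ⋆ g) n
    ≡⟨ ∑-cong (suc n) (λ k _ → trans (cong (_* g (n ∸ k)) (sym (∑-*ˡ (n C k) (λ a → h a k) N)))
                                      (sym (∑-*ʳ (g (n ∸ k)) (λ a → (n C k) * h a k) N))) ⟩
  ∑[ k < suc n ] ∑[ a < N ] (n C k) * h a k * g (n ∸ k)
    ≡⟨ ∑-comm (λ k a → (n C k) * h a k * g (n ∸ k)) (suc n) N ⟩
  ∑[ a < N ] (h a ⋆ g) n ∎

⋆-∑ʳ : ∀ (h : ℕ → ℕ → ℕ) f N n → (f ⋆ (λ k → ∑[ b < N ] h b k)) n ≡ ∑[ b < N ] (f ⋆ h b) n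
⋆-∑ʳ h f N n = begin
  (f ⋆ (λ k → ∑[ b < N ] h b k)) n
    ≡⟨ ∑-cong (suc n) (λ k _ → ∑-*ˡ ((n C k) * f k) (λ b → h b (n ∸ k)) N) ⟨
  ∑[ k < suc n ] ∑[ b < N ] (n C k) * f k * h b (n ∸ k)
    ≡⟨ ∑-comm (λ k b → (n C k) * f k * h b (n ∸ k)) (suc n) N ⟩
  ∑[ b < N ] (f ⋆ h b) n ∎

coverings-⋆ : ∀ n s₁ s₂ a b →
  ((λ k → coverings k s₁ a) ⋆ (λ k → coverings k s₂ b)) n ≡ coverings n (s₁ + s₂) (a + b)
coverings-⋆ zero    s₁ s₂ zero    zero    = refl
coverings-⋆ zero    s₁ s₂ zero    (suc b) = refl
coverings-⋆ zero    s₁ s₂ (suc a) zero    = refl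
coverings-⋆ zero    s₁ s₂ (suc a) (suc b) = refl
coverings-⋆ (suc n) s₁ s₂ a b = begin
  (F₁ ⋆ F₂) (suc n)
    ≡⟨ ⋆-suc F₁ F₂ n ⟩
  ((F₁ ∘ suc) ⋆ F₂) n + (F₁ ⋆ (F₂ ∘ suc)) n
    ≡⟨ cong₂ _+_ (⋆-linearˡ a s₁ (λ k → coverings k (suc s₁) (pred a)) F₁ F₂ n)
                 (⋆-linearʳ b s₂ F₁ (λ k → coverings k (suc s₂) (pred b)) F₂ n) ⟩
  (a * ((λ k → coverings k (suc s₁) (pred a)) ⋆ F₂) n + s₁ * (F₁ ⋆ F₂) n)
    + (b * (F₁ ⋆ (λ k → coverings k (suc s₂) (pred b))) n + s₂ * (F₁ ⋆ F₂) n)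
    ≡⟨ cong₂ _+_ (cong₂ _+_ (cong (a *_) (coverings-⋆ n (suc s₁) s₂ (pred a) b))
                            (cong (s₁ *_) (coverings-⋆ n s₁ s₂ a b)))
                 (cong₂ _+_ (cong (b *_) (coverings-⋆ n s₁ (suc s₂) a (pred b)))
                            (cong (s₂ *_) (coverings-⋆ n s₁ s₂ a b))) ⟩
  (a * coverings n (suc s₁ + s₂) (pred a + b) + s₁ * Y) + (b * coverings n (s₁ + suc s₂) (a + pred b) + s₂ * Y)
    ≡⟨ cong₂ _+_ (cong (_+ s₁ * Y) (pred-+ˡ a b))
                 (cong (_+ s₂ * Y) (trans (cong (λ t → b * coverings n t (a + pred b)) (+-suc s₁ s₂))
                                          (pred-+ʳ a b))) ⟩
  (a * X + s₁ * Y) + (b * X + s₂ * Y)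
    ≡⟨ collect a b s₁ s₂ X Y ⟩
  (a + b) * X + (s₁ + s₂) * Y ∎
  where
  F₁ = λ k → coverings k s₁ a
  F₂ = λ k → coverings k s₂ b
  X = coverings n (suc (s₁ + s₂)) (pred (a + b))
  Y = coverings n (s₁ + s₂) (a + b)
  -- the factor a (resp. b) kills the term in which pred truncates
  pred-+ˡ : ∀ a b → a * coverings n (suc (s₁ + s₂)) (pred a + b) ≡ a * coverings n (suc (s₁ + s₂)) (pred (a + b))
  pred-+ˡ zero    b = refl
  pred-+ˡ (suc a) b = refl
  pred-+ʳ : ∀ a b → b * coverings n (suc (s₁ + s₂)) (a + pred b) ≡ b * coverings n (suc (s₁ + s₂)) (pred (a + b))
  pred-+ʳ a zero    = refl
  pred-+ʳ a (suc b) = cong (λ t → suc b * coverings n (suc (s₁ + s₂)) (pred t)) (sym (+-suc a b))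
  collect : ∀ a b s₁ s₂ X Y → (a * X + s₁ * Y) + (b * X + s₂ * Y) ≡ (a + b) * X + (s₁ + s₂) * Y
  collect = solve-∀

∑∑-triangle : ∀ (h : ℕ → ℕ) N → ∑[ a < N ] ∑[ b < N ∸ a ] h (a + b) ≡ ∑[ K < N ] suc K * h K
∑∑-triangle h zero    = refl
∑∑-triangle h (suc N) = begin
  ∑[ a < N ] ∑[ b < suc N ∸ a ] h (a + b) + ∑[ b < suc N ∸ N ] h (N + b)
    ≡⟨ cong₂ _+_ (∑-cong N (λ a a<N → cong (λ m → ∑[ b < m ] h (a + b)) (+-∸-assoc 1 (<⇒≤ a<N))))
                 (cong (λ m → ∑[ b < m ] h (N + b)) (m+n∸n≡m 1 N)) ⟩
  ∑[ a < N ] (∑[ b < N ∸ a ] h (a + b) + h (a + (N ∸ a))) + (0 + h (N + 0))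
    ≡⟨ cong₂ _+_ (∑-distrib-+ _ _ N) (cong h (+-identityʳ N)) ⟩
  ∑[ a < N ] ∑[ b < N ∸ a ] h (a + b) + ∑[ a < N ] h (a + (N ∸ a)) + h N
    ≡⟨ cong (λ t → ∑[ a < N ] ∑[ b < N ∸ a ] h (a + b) + t + h N)
            (trans (∑-cong N (λ a a<N → cong h (m+[n∸m]≡n (<⇒≤ a<N)))) (∑-const (h N) N)) ⟩
  ∑[ a < N ] ∑[ b < N ∸ a ] h (a + b) + N * h N + h N
    ≡⟨ cong (λ t → t + N * h N + h N) (∑∑-triangle h N) ⟩
  ∑[ K < N ] suc K * h K + N * h N + h N
    ≡⟨ trans (+-assoc _ (N * h N) (h N)) (cong (∑[ K < N ] suc K * h K +_) (+-comm (N * h N) (h N))) ⟩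
  ∑[ K < suc N ] suc K * h K ∎

∑∑-antidiagonal : ∀ (h : ℕ → ℕ) N → (∀ K → N ≤ K → h K ≡ 0) →
                  ∑[ a < N ] ∑[ b < N ] h (a + b) ≡ ∑[ K < N ] suc K * h K
∑∑-antidiagonal h N vanish = trans (∑-cong N truncate) (∑∑-triangle h N)
  where
  truncate : ∀ a → a < N → ∑[ b < N ] h (a + b) ≡ ∑[ b < N ∸ a ] h (a + b)
  truncate a a<N = sym (∑-extend (λ b → h (a + b)) (m∸n≤m N a)
    (λ b N∸a≤b → vanish (a + b) (subst (_≤ a + b) (m+[n∸m]≡n (<⇒≤ a<N)) (+-monoʳ-≤ a N∸a≤b))))

fubini : ℕ → ℕ
fubini n = ∑[ k < suc n ] coverings n 0 k

fubini-⋆-fubini : ∀ n → (fubini ⋆ fubini) n ≡ ∑[ K < suc n ] suc K * coverings n 0 K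
fubini-⋆-fubini n = begin
  (fubini ⋆ fubini) n
    ≡⟨ ⋆-cong n widen widen ⟩
  (fubini′ ⋆ fubini′) n
    ≡⟨ ⋆-∑ˡ (λ a k → coverings k 0 a) fubini′ N n ⟩
  ∑[ a < N ] ((λ k → coverings k 0 a) ⋆ fubini′) n
    ≡⟨ ∑-cong N (λ a _ → ⋆-∑ʳ (λ b k → coverings k 0 b) (λ k → coverings k 0 a) N n) ⟩
  ∑[ a < N ] ∑[ b < N ] ((λ k → coverings k 0 a) ⋆ (λ k → coverings k 0 b)) n
    ≡⟨ ∑-cong N (λ a _ → ∑-cong N (λ b _ → coverings-⋆ n 0 0 a b)) ⟩
  ∑[ a < N ] ∑[ b < N ] coverings n 0 (a + b)
    ≡⟨ ∑∑-antidiagonal (coverings n 0) N (λ K N≤K → coverings-vanish n 0 K N≤K) ⟩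
  ∑[ K < N ] suc K * coverings n 0 K ∎
  where
  N = suc n
  fubini′ : ℕ → ℕ
  fubini′ k = ∑[ a < N ] coverings k 0 a
  widen : ∀ k → k ≤ n → fubini k ≡ fubini′ k
  widen k k≤n = ∑-extend (coverings k 0) (s≤s k≤n) (λ a k<a → coverings-vanish k 0 a k<a)

private variable A B : Set

count : (A → Bool) → List A → ℕ
count p xs = length (filterᵇ p xs)

count-∷ : ∀ (p : A → Bool) x xs → count p (x ∷ xs) ≡ ⟦ p x ⟧ + count p xs
count-∷ p x xs with p x
... | true  = refl
... | false = refl

count-++ : ∀ (p : A → Bool) xs ys → count p (xs ++ ys) ≡ count p xs + count p ys
count-++ p xs ys = trans (cong length (filter-++ (T? ∘ p) xs ys)) (length-++ (filterᵇ p xs))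

count-concatMap : ∀ (p : A → Bool) (f : B → List A) xs → count p (concatMap f xs) ≡ sum (map (count p ∘ f) xs)
count-concatMap p f []       = refl
count-concatMap p f (x ∷ xs) = trans (count-++ p (f x) (concatMap f xs)) (cong (count p (f x) +_) (count-concatMap p f xs))

count-map : ∀ (p : A → Bool) (f : B → A) xs → count p (map f xs) ≡ count (p ∘ f) xs
count-map p f []       = refl
count-map p f (x ∷ xs) = begin
  count p (f x ∷ map f xs)        ≡⟨ count-∷ p (f x) (map f xs) ⟩
  ⟦ p (f x) ⟧ + count p (map f xs) ≡⟨ cong (⟦ p (f x) ⟧ +_) (count-map p f xs) ⟩
  ⟦ p (f x) ⟧ + count (p ∘ f) xs   ≡⟨ count-∷ (p ∘ f) x xs ⟨
  count (p ∘ f) (x ∷ xs)          ∎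

count-cong : ∀ {p q : A → Bool} xs → (∀ x → p x ≡ q x) → count p xs ≡ count q xs
count-cong {p = p} {q} []       p≗q = refl
count-cong {p = p} {q} (x ∷ xs) p≗q = begin
  count p (x ∷ xs)        ≡⟨ count-∷ p x xs ⟩
  ⟦ p x ⟧ + count p xs    ≡⟨ cong₂ _+_ (cong ⟦_⟧ (p≗q x)) (count-cong xs p≗q) ⟩
  ⟦ q x ⟧ + count q xs    ≡⟨ count-∷ q x xs ⟨
  count q (x ∷ xs)        ∎

count-const-∧ : ∀ b (q : A → Bool) xs → count (λ x → b ∧ q x) xs ≡ ⟦ b ⟧ * count q xs
count-const-∧ true  q xs = sym (+-identityʳ _)
count-const-∧ false q xs = count-zero xs
  where
  count-zero : ∀ (xs : List A) → count (λ _ → false) xs ≡ 0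
  count-zero []       = refl
  count-zero (_ ∷ xs) = count-zero xs

all-any⇒common : ∀ (p q : A → Bool) w → all p w ≡ true → any q w ≡ true →
                 Σ A (λ x → p x ≡ true × q x ≡ true)
all-any⇒common p q (x ∷ w) all-p any-q with p x in px | q x in qx
... | true | true  = x , px , qx
... | true | false = all-any⇒common p q w all-p any-q

count-any-disjoint : ∀ (P : ℕ → A → Bool) (q : A → Bool) N xs →
  (∀ x {k k′} → P k x ≡ true → P k′ x ≡ true → k ≡ k′) →
  count (λ x → any (λ k → P k x) (upTo N) ∧ q x) xs ≡ ∑[ k < N ] count (λ x → P k x ∧ q x) xs
count-any-disjoint P q N []       disjoint = sym (∑-zeros N (λ _ _ → refl))
count-any-disjoint P q N (x ∷ xs) disjoint = begin
  count (λ x → any (λ k → P k x) (upTo N) ∧ q x) (x ∷ xs)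
    ≡⟨ count-∷ _ x xs ⟩
  ⟦ any (λ k → P k x) (upTo N) ∧ q x ⟧ + count (λ x → any (λ k → P k x) (upTo N) ∧ q x) xs
    ≡⟨ cong₂ _+_ (trans (cong (λ b → ⟦ b ∧ q x ⟧) (any-applyUpTo (λ k → P k x) (λ i → i) N))
                        (⟦⋁∧⟧ (λ k → P k x) (q x) N (disjoint x)))
                 (count-any-disjoint P q N xs disjoint) ⟩
  ∑[ k < N ] ⟦ P k x ∧ q x ⟧ + ∑[ k < N ] count (λ x → P k x ∧ q x) xs
    ≡⟨ ∑-distrib-+ _ _ N ⟨
  ∑[ k < N ] (⟦ P k x ∧ q x ⟧ + count (λ x → P k x ∧ q x) xs)
    ≡⟨ ∑-cong N (λ k _ → sym (count-∷ (λ x → P k x ∧ q x) x xs)) ⟩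
  ∑[ k < N ] count (λ x → P k x ∧ q x) (x ∷ xs) ∎

count-words-suc : ∀ p n m → count p (words (suc n) m) ≡ ∑[ i < m ] count (λ w → p (suc i ∷ w)) (words n m)
count-words-suc p n m = begin
  count p (words (suc n) m)
    ≡⟨ count-concatMap p (λ a → map (a ∷_) (words n m)) (oneTo m) ⟩
  sum (map (λ a → count p (map (a ∷_) (words n m))) (oneTo m))
    ≡⟨ sum-applyUpTo _ suc m ⟩
  ∑[ i < m ] count p (map (suc i ∷_) (words n m))
    ≡⟨ ∑-cong m (λ i _ → count-map p (suc i ∷_) (words n m)) ⟩
  ∑[ i < m ] count (λ w → p (suc i ∷ w)) (words n m) ∎

count-words-cong : ∀ n m {p q} → (∀ w → length w ≡ n → p w ≡ q w) → count p (words n m) ≡ count q (words n m)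
count-words-cong zero    m {p} {q} p≗q = begin
  count p ([] ∷ [])  ≡⟨ count-∷ p [] [] ⟩
  ⟦ p [] ⟧ + 0       ≡⟨ cong (λ b → ⟦ b ⟧ + 0) (p≗q [] refl) ⟩
  ⟦ q [] ⟧ + 0       ≡⟨ count-∷ q [] [] ⟨
  count q ([] ∷ [])  ∎
count-words-cong (suc n) m {p} {q} p≗q = begin
  count p (words (suc n) m)                           ≡⟨ count-words-suc p n m ⟩
  ∑[ i < m ] count (λ w → p (suc i ∷ w)) (words n m)
    ≡⟨ ∑-cong m (λ i _ → count-words-cong n m (λ w len → p≗q (suc i ∷ w) (cong suc len))) ⟩
  ∑[ i < m ] count (λ w → q (suc i ∷ w)) (words n m)   ≡⟨ count-words-suc q n m ⟨
  count q (words (suc n) m)                           ∎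

≤⇒≤ᵇ≡true : ∀ {m n} → m ≤ n → (m ≤ᵇ n) ≡ true
≤⇒≤ᵇ≡true m≤n = Equivalence.to T-≡ (≤⇒≤ᵇ m≤n)

>⇒≤ᵇ≡false : ∀ {m n} → n < m → (m ≤ᵇ n) ≡ false
>⇒≤ᵇ≡false {m} {n} n<m with m ≤ᵇ n in eq
... | false = refl
... | true  = ⊥-elim (<⇒≱ n<m (≤ᵇ⇒≤ m n (Equivalence.from T-≡ eq)))

≡ᵇ≡true⇒≡ : ∀ {m n} → (m ≡ᵇ n) ≡ true → m ≡ n
≡ᵇ≡true⇒≡ {m} {n} eq = ≡ᵇ⇒≡ m n (Equivalence.from T-≡ eq)

≢⇒≡ᵇ≡false : ∀ {m n} → m ≢ n → (m ≡ᵇ n) ≡ false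
≢⇒≡ᵇ≡false {m} {n} m≢n with m ≡ᵇ n in eq
... | false = refl
... | true  = ⊥-elim (m≢n (≡ᵇ≡true⇒≡ eq))

≡ᵇ-sym : ∀ m n → (m ≡ᵇ n) ≡ (n ≡ᵇ m)
≡ᵇ-sym zero    zero    = refl
≡ᵇ-sym zero    (suc n) = refl
≡ᵇ-sym (suc m) zero    = refl
≡ᵇ-sym (suc m) (suc n) = ≡ᵇ-sym m n

≡ᵇ-refl : ∀ n → (n ≡ᵇ n) ≡ true
≡ᵇ-refl n = Equivalence.to T-≡ (≡⇒≡ᵇ n n refl)

∧≡true⁻ : ∀ {a b} → (a ∧ b) ≡ true → a ≡ true × b ≡ true
∧≡true⁻ {true} {true} _ = refl , refl

separated-by : ∀ (p : ℕ → Bool) {a b} → p a ≡ false → p b ≡ true → a ≢ b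
separated-by p pa pb refl with trans (sym pa) pb
... | ()

-- Sets of letters are Boolean predicates; the letters of [1..m] are suc i for i < m.
card : ℕ → (ℕ → Bool) → ℕ
card m p = ∑[ i < m ] ⟦ p (suc i) ⟧

_∖_ : (ℕ → Bool) → (ℕ → Bool) → ℕ → Bool
(p ∖ q) j = p j ∧ not (q j)

delete : ℕ → (ℕ → Bool) → ℕ → Bool
delete a p = p ∖ (_≡ᵇ a)

_⊆_ : (ℕ → Bool) → (ℕ → Bool) → Set
p ⊆ q = ∀ j → p j ≡ true → q j ≡ true

⊆-refl : ∀ {p} → p ⊆ p
⊆-refl _ pj = pj

card-cong : ∀ {p q} m → (∀ j → p j ≡ q j) → card m p ≡ card m q
card-cong m p≗q = ∑-cong m (λ i _ → cong ⟦_⟧ (p≗q (suc i)))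

card-singleton : ∀ (p : ℕ → Bool) {m i} → i < m → card m (λ j → p j ∧ (j ≡ᵇ suc i)) ≡ ⟦ p (suc i) ⟧
card-singleton p {m} {i} i<m = begin
  card m (λ j → p j ∧ (j ≡ᵇ suc i))
    ≡⟨ ∑-extend term i<m (λ j i<j → off j (<⇒≢ i<j ∘ sym)) ⟨
  ∑[ j < i ] term j + ⟦ p (suc i) ∧ (i ≡ᵇ i) ⟧
    ≡⟨ cong₂ _+_ (∑-zeros i (λ j j<i → off j (<⇒≢ j<i))) (cong (λ b → ⟦ p (suc i) ∧ b ⟧) (≡ᵇ-refl i)) ⟩
  ⟦ p (suc i) ∧ true ⟧
    ≡⟨ cong ⟦_⟧ (∧-identityʳ (p (suc i))) ⟩
  ⟦ p (suc i) ⟧ ∎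
  where
  term : ℕ → ℕ
  term j = ⟦ p (suc j) ∧ (j ≡ᵇ i) ⟧
  off : ∀ j → j ≢ i → term j ≡ 0
  off j j≢i = trans (cong (λ b → ⟦ p (suc j) ∧ b ⟧) (≢⇒≡ᵇ≡false j≢i)) (cong ⟦_⟧ (∧-zeroʳ (p (suc j))))

card-delete : ∀ (p : ℕ → Bool) {m i} → i < m → card m p ≡ card m (delete (suc i) p) + ⟦ p (suc i) ⟧
card-delete p {m} {i} i<m = begin
  card m p
    ≡⟨ ∑-cong m (λ j _ → split (p (suc j)) (j ≡ᵇ i)) ⟩
  ∑[ j < m ] (⟦ delete (suc i) p (suc j) ⟧ + ⟦ p (suc j) ∧ (j ≡ᵇ i) ⟧)
    ≡⟨ ∑-distrib-+ _ _ m ⟩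
  card m (delete (suc i) p) + card m (λ j → p j ∧ (j ≡ᵇ suc i))
    ≡⟨ cong (card m (delete (suc i) p) +_) (card-singleton p i<m) ⟩
  card m (delete (suc i) p) + ⟦ p (suc i) ⟧ ∎
  where
  split : ∀ b c → ⟦ b ⟧ ≡ ⟦ b ∧ not c ⟧ + ⟦ b ∧ c ⟧
  split true  true  = refl
  split true  false = refl
  split false c     = refl

card-delete-∈ : ∀ (p : ℕ → Bool) {m i} → i < m → p (suc i) ≡ true → card m p ≡ suc (card m (delete (suc i) p))
card-delete-∈ p {m} {i} i<m p[1+i] = begin
  card m p                                   ≡⟨ card-delete p i<m ⟩
  card m (delete (suc i) p) + ⟦ p (suc i) ⟧   ≡⟨ cong (λ b → card m (delete (suc i) p) + ⟦ b ⟧) p[1+i] ⟩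
  card m (delete (suc i) p) + 1              ≡⟨ +-comm _ 1 ⟩
  suc (card m (delete (suc i) p))            ∎

delete-∉ : ∀ (p : ℕ → Bool) {a} → p a ≡ false → ∀ j → delete a p j ≡ p j
delete-∉ p {a} pa≡false j with j ≡ᵇ a in eq
... | false = ∧-identityʳ (p j)
... | true  = trans (∧-zeroʳ (p j)) (sym (subst (λ k → p k ≡ false) (sym (≡ᵇ≡true⇒≡ eq)) pa≡false))

delete-self : ∀ (p : ℕ → Bool) a → delete a p a ≡ false
delete-self p a rewrite ≡ᵇ-refl a = ∧-zeroʳ (p a)

delete-⊆ : ∀ {req al} a → req ⊆ al → delete a req ⊆ al
delete-⊆ {req} a req⊆al j eq with req j in req[j]
... | true = req⊆al j req[j]

card-∖-delete : ∀ (al req : ℕ → Bool) {m i} → i < m → req (suc i) ≡ true → al (suc i) ≡ true →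
                card m (al ∖ delete (suc i) req) ≡ suc (card m (al ∖ req))
card-∖-delete al req {m} {i} i<m req[a] al[a] = begin
  card m (al ∖ delete a req)
    ≡⟨ card-delete (al ∖ delete a req) i<m ⟩
  card m (delete a (al ∖ delete a req)) + ⟦ (al ∖ delete a req) a ⟧
    ≡⟨ cong₂ _+_ (card-cong m (λ j → same (al j) (req j) (j ≡ᵇ a)))
                 (trans (cong (λ b → ⟦ al a ∧ not b ⟧) (delete-self req a))
                        (cong ⟦_⟧ (trans (∧-identityʳ (al a)) al[a]))) ⟩
  card m (delete a (al ∖ req)) + 1
    ≡⟨ cong (_+ 1) (card-cong m (delete-∉ (al ∖ req) (trans (cong (λ b → al a ∧ not b) req[a])
                                                            (∧-zeroʳ (al a))))) ⟩
  card m (al ∖ req) + 1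
    ≡⟨ +-comm _ 1 ⟩
  suc (card m (al ∖ req)) ∎
  where
  a = suc i
  same : ∀ x r c → ((x ∧ not (r ∧ not c)) ∧ not c) ≡ ((x ∧ not r) ∧ not c)
  same false r c     = refl
  same true  r true  = trans (∧-zeroʳ _) (sym (∧-zeroʳ _))
  same true  r false = cong (λ b → (true ∧ not b) ∧ true) (∧-identityʳ r)

card-∖-self : ∀ m p → card m (p ∖ p) ≡ 0
card-∖-self m p = ∑-zeros m (λ i _ → cong ⟦_⟧ (∧-inverseʳ (p (suc i))))

-- Words covering a set of letters

covers : ℕ → (ℕ → Bool) → List ℕ → Bool
covers m req w = all (λ j → not (req j) ∨ elem j w) (oneTo m)

covers-∷ : ∀ m req a w → covers m req (a ∷ w) ≡ covers m (delete a req) w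
covers-∷ m req a w = begin
  covers m req (a ∷ w)
    ≡⟨ all-applyUpTo _ suc m ⟩
  ⋀[ i < m ] (not (req (suc i)) ∨ elem (suc i) (a ∷ w))
    ≡⟨ ⋀-cong m (λ i _ → pointwise (suc i) (req (suc i)) (suc i ≡ᵇ a)) ⟩
  ⋀[ i < m ] (not (delete a req (suc i)) ∨ elem (suc i) w)
    ≡⟨ all-applyUpTo _ suc m ⟨
  covers m (delete a req) w ∎
  where
  pointwise : ∀ j r c → (not r ∨ (c ∨ elem j w)) ≡ (not (r ∧ not c) ∨ elem j w)
  pointwise j true  true  = refl
  pointwise j true  false = refl
  pointwise j false c     = refl

⟦covers-[]⟧ : ∀ m req s → ⟦ covers m req [] ⟧ ≡ coverings 0 s (card m req)
⟦covers-[]⟧ m req s = trans (cong ⟦_⟧ (all-applyUpTo _ suc m)) (go m)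
  where
  go : ∀ m → ⟦ ⋀[ i < m ] (not (req (suc i)) ∨ false) ⟧ ≡ coverings 0 s (card m req)
  go zero    = refl
  go (suc m) with req (suc m)
  ... | true  rewrite ∧-zeroʳ (⋀[ i < m ] (not (req (suc i)) ∨ false)) | +-comm (card m req) 1 = refl
  ... | false rewrite ∧-identityʳ (⋀[ i < m ] (not (req (suc i)) ∨ false)) | +-identityʳ (card m req) = go m

covering : ℕ → (ℕ → Bool) → (ℕ → Bool) → List ℕ → Bool
covering m al req w = all al w ∧ covers m req w

covering-∷ : ∀ m al req a w → covering m al req (a ∷ w) ≡ al a ∧ covering m al (delete a req) w
covering-∷ m al req a w =
  trans (∧-assoc (al a) (all al w) _) (cong (λ c → al a ∧ (all al w ∧ c)) (covers-∷ m req a w))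

∑-weighted-card : ∀ m X Y (p q : ℕ → Bool) →
            ∑[ i < m ] (⟦ p (suc i) ⟧ * X + ⟦ q (suc i) ⟧ * Y) ≡ card m p * X + card m q * Y
∑-weighted-card m X Y p q =
  trans (∑-distrib-+ _ _ m) (cong₂ _+_ (∑-*ʳ X (λ i → ⟦ p (suc i) ⟧) m) (∑-*ʳ Y (λ i → ⟦ q (suc i) ⟧) m))

count-covering : ∀ n m al req → req ⊆ al →
                 count (covering m al req) (words n m) ≡ coverings n (card m (al ∖ req)) (card m req)
count-covering zero    m al req _       =
  trans (count-∷ (covering m al req) [] []) (trans (+-identityʳ _) (⟦covers-[]⟧ m req _))
count-covering (suc n) m al req req⊆al = begin
  count (covering m al req) (words (suc n) m)
    ≡⟨ count-words-suc _ n m ⟩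
  ∑[ i < m ] count (λ w → covering m al req (suc i ∷ w)) (words n m)
    ≡⟨ ∑-cong m (λ i _ → trans (count-cong (words n m) (covering-∷ m al req (suc i)))
                               (count-const-∧ (al (suc i)) _ (words n m))) ⟩
  ∑[ i < m ] ⟦ al (suc i) ⟧ * count (covering m al (delete (suc i) req)) (words n m)
    ≡⟨ ∑-cong m (λ i i<m → trans (cong (⟦ al (suc i) ⟧ *_) (count-covering n m al _ (delete-⊆ (suc i) req⊆al)))
                                 (first-letter i<m)) ⟩
  ∑[ i < m ] (⟦ req (suc i) ⟧ * X + ⟦ (al ∖ req) (suc i) ⟧ * Y)
    ≡⟨ ∑-weighted-card m X Y req (al ∖ req) ⟩
  card m req * X + card m (al ∖ req) * Y ∎
  where
  X = coverings n (suc (card m (al ∖ req))) (pred (card m req))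
  Y = coverings n (card m (al ∖ req)) (card m req)
  first-letter : ∀ {i} → i < m →
    ⟦ al (suc i) ⟧ * coverings n (card m (al ∖ delete (suc i) req)) (card m (delete (suc i) req))
    ≡ ⟦ req (suc i) ⟧ * X + ⟦ (al ∖ req) (suc i) ⟧ * Y
  first-letter {i} i<m with req (suc i) in req[a]
  ... | true  rewrite req⊆al (suc i) req[a]
                    | card-∖-delete al req i<m req[a] (req⊆al (suc i) req[a])
                    | card-delete-∈ req i<m req[a] = sym (+-identityʳ _)
  ... | false rewrite card-cong m (delete-∉ req req[a])
                    | card-cong m (λ j → cong (λ c → al j ∧ not c) (delete-∉ req req[a] j))
                    | ∧-identityʳ (al (suc i)) = refl

coveringAfter : ℕ → ℕ → (ℕ → Bool) → (ℕ → Bool) → ℕ → ℕ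
coveringAfter n m al req x = count (λ w → covering m al req w ∧ noAdjEq (suc x ∷ w)) (words n m)

-- The preceding letter suc x is free, and it is the one free letter that may not come next.
count-coveringAfter : ∀ n m al req → req ⊆ al → ∀ {x s} → x < m → al (suc x) ≡ true → req (suc x) ≡ false →
                      card m (al ∖ req) ≡ suc s → coveringAfter n m al req x ≡ coverings n s (card m req)
count-coveringAfter zero    m al req _ {x} _ _ _ _ =
  trans (count-∷ (λ w → covering m al req w ∧ noAdjEq (suc x ∷ w)) [] [])
        (trans (+-identityʳ _) (trans (cong ⟦_⟧ (∧-identityʳ _)) (⟦covers-[]⟧ m req _)))
count-coveringAfter (suc n) m al req req⊆al {x} {s} x<m al[x] req[x] free = begin
  coveringAfter (suc n) m al req x
    ≡⟨ count-words-suc _ n m ⟩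
  ∑[ i < m ] count (λ w → covering m al req (suc i ∷ w) ∧ (not (x ≡ᵇ i) ∧ noAdjEq (suc i ∷ w))) (words n m)
    ≡⟨ ∑-cong m (λ i _ → trans (count-cong (words n m) (λ w → regroup i w))
                               (count-const-∧ (al (suc i) ∧ not (x ≡ᵇ i)) _ (words n m))) ⟩
  ∑[ i < m ] ⟦ al (suc i) ∧ not (x ≡ᵇ i) ⟧ * coveringAfter n m al (delete (suc i) req) i
    ≡⟨ ∑-cong m (λ i i<m → next-letter i<m) ⟩
  ∑[ i < m ] (⟦ req (suc i) ⟧ * X + ⟦ delete (suc x) (al ∖ req) (suc i) ⟧ * Y)
    ≡⟨ ∑-weighted-card m X Y req (delete (suc x) (al ∖ req)) ⟩
  card m req * X + card m (delete (suc x) (al ∖ req)) * Y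
    ≡⟨ cong (λ c → card m req * X + c * Y) free-besides-x ⟩
  card m req * X + s * Y ∎
  where
  X = coverings n (suc s) (pred (card m req))
  Y = coverings n s (card m req)
  regroup : ∀ i w → (covering m al req (suc i ∷ w) ∧ (not (x ≡ᵇ i) ∧ noAdjEq (suc i ∷ w)))
                    ≡ (al (suc i) ∧ not (x ≡ᵇ i)) ∧ (covering m al (delete (suc i) req) w ∧ noAdjEq (suc i ∷ w))
  regroup i w = trans (cong (_∧ (not (x ≡ᵇ i) ∧ noAdjEq (suc i ∷ w))) (covering-∷ m al req (suc i) w))
                      (∧-interchange (al (suc i)) _ (not (x ≡ᵇ i)) _)
  free-besides-x : card m (delete (suc x) (al ∖ req)) ≡ s
  free-besides-x = suc-injective (trans (sym (card-delete-∈ (al ∖ req) x<m x-free)) free)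
    where
    x-free : (al ∖ req) (suc x) ≡ true
    x-free rewrite al[x] | req[x] = refl
  next-letter : ∀ {i} → i < m →
    ⟦ al (suc i) ∧ not (x ≡ᵇ i) ⟧ * coveringAfter n m al (delete (suc i) req) i
    ≡ ⟦ req (suc i) ⟧ * X + ⟦ delete (suc x) (al ∖ req) (suc i) ⟧ * Y
  next-letter {i} i<m with req (suc i) in req[a]
  ... | true
    rewrite req⊆al (suc i) req[a]
          | ≢⇒≡ᵇ≡false {x} {i} (separated-by req req[x] req[a] ∘ cong suc)
          | count-coveringAfter n m al (delete (suc i) req) (delete-⊆ (suc i) req⊆al) i<m
              (req⊆al (suc i) req[a]) (delete-self req (suc i))
              (trans (card-∖-delete al req i<m req[a] (req⊆al (suc i) req[a])) (cong suc free))
          | card-delete-∈ req i<m req[a] = sym (+-identityʳ _)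
  ... | false with al (suc i) in al[a]
  ...   | false = refl
  ...   | true with x ≡ᵇ i in x≡ᵇi
  ...     | true rewrite ≡ᵇ-sym i x | x≡ᵇi = refl
  ...     | false
    rewrite ≡ᵇ-sym i x | x≡ᵇi
          | count-coveringAfter n m al (delete (suc i) req) (delete-⊆ (suc i) req⊆al) i<m al[a] (delete-self req (suc i))
              (trans (card-cong m (λ j → cong (λ c → al j ∧ not c) (delete-∉ req req[a] j))) free)
          | card-cong m (delete-∉ req req[a]) = refl

count-onto : ∀ n m al → count (covering m al al) (words n m) ≡ coverings n 0 (card m al)
count-onto n m al =
  trans (count-covering n m al al ⊆-refl) (cong (λ s → coverings n s (card m al)) (card-∖-self m al))

count-onto-noAdjEq : ∀ n m al →
  count (λ w → covering m al al w ∧ noAdjEq w) (words (suc n) m) ≡ card m al * coverings n 0 (pred (card m al))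
count-onto-noAdjEq n m al = begin
  count (λ w → covering m al al w ∧ noAdjEq w) (words (suc n) m)
    ≡⟨ count-words-suc _ n m ⟩
  ∑[ i < m ] count (λ w → covering m al al (suc i ∷ w) ∧ noAdjEq (suc i ∷ w)) (words n m)
    ≡⟨ ∑-cong m (λ i _ → trans (count-cong (words n m) (λ w → regroup i w))
                               (count-const-∧ (al (suc i)) _ (words n m))) ⟩
  ∑[ i < m ] ⟦ al (suc i) ⟧ * coveringAfter n m al (delete (suc i) al) i
    ≡⟨ ∑-cong m (λ i i<m → first-letter i<m) ⟩
  ∑[ i < m ] ⟦ al (suc i) ⟧ * coverings n 0 (pred (card m al))
    ≡⟨ ∑-*ʳ _ (λ i → ⟦ al (suc i) ⟧) m ⟩
  card m al * coverings n 0 (pred (card m al)) ∎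
  where
  regroup : ∀ i w → (covering m al al (suc i ∷ w) ∧ noAdjEq (suc i ∷ w))
                    ≡ al (suc i) ∧ (covering m al (delete (suc i) al) w ∧ noAdjEq (suc i ∷ w))
  regroup i w = trans (cong (_∧ noAdjEq (suc i ∷ w)) (covering-∷ m al al (suc i) w)) (∧-assoc (al (suc i)) _ _)
  first-letter : ∀ {i} → i < m → ⟦ al (suc i) ⟧ * coveringAfter n m al (delete (suc i) al) i
                                 ≡ ⟦ al (suc i) ⟧ * coverings n 0 (pred (card m al))
  first-letter {i} i<m with al (suc i) in al[a]
  ... | false = refl
  ... | true  = cong (1 *_) (begin
    coveringAfter n m al (delete (suc i) al) i
      ≡⟨ count-coveringAfter n m al (delete (suc i) al) (delete-⊆ (suc i) ⊆-refl) i<m al[a] (delete-self al (suc i))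
           (trans (card-∖-delete al al i<m al[a] al[a]) (cong suc (card-∖-self m al))) ⟩
    coverings n 0 (card m (delete (suc i) al))
      ≡⟨ cong (coverings n 0 ∘ pred) (card-delete-∈ al i<m al[a]) ⟨
    coverings n 0 (pred (card m al)) ∎)

-- Cayley permutations

inOneTo : ℕ → ℕ → Bool
inOneTo k x = (1 ≤ᵇ x) ∧ (x ≤ᵇ k)

hasImageOneTo : ℕ → List ℕ → Bool
hasImageOneTo k w = all (inOneTo k) w ∧ all (λ j → elem j w) (oneTo k)

∈-oneTo : ∀ w {k i} → all (λ j → elem j w) (oneTo k) ≡ true → i < k → elem (suc i) w ≡ true
∈-oneTo w {k} all-in i<k = ⋀-elim (λ j → elem (suc j) w) (trans (sym (all-applyUpTo (λ j → elem j w) suc k)) all-in) i<k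

hasImageOneTo-< : ∀ w {k k′} → k < k′ → hasImageOneTo k w ≡ true → hasImageOneTo k′ w ≡ false
hasImageOneTo-< w {k} {suc i} (s≤s k≤i) image-k with hasImageOneTo (suc i) w in image-k′
... | false = refl
... | true with all-any⇒common (inOneTo k) (suc i ≡ᵇ_) w (proj₁ (∧≡true⁻ image-k))
                              (∈-oneTo w (proj₂ (∧≡true⁻ {all (inOneTo (suc i)) w} image-k′)) ≤-refl)
...   | x , x∈[1,k] , 1+i≡ᵇx =
  ⊥-elim (<⇒≱ (s≤s k≤i) (subst (_≤ k) (sym (≡ᵇ≡true⇒≡ 1+i≡ᵇx))
                                 (≤ᵇ⇒≤ x k (Equivalence.from T-≡ (proj₂ (∧≡true⁻ x∈[1,k]))))))

hasImageOneTo-unique : ∀ w {k k′} → hasImageOneTo k w ≡ true → hasImageOneTo k′ w ≡ true → k ≡ k′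
hasImageOneTo-unique w {k} {k′} image-k image-k′ with <-cmp k k′
... | tri≈ _ k≡k′ _ = k≡k′
... | tri< k<k′ _ _ = contradiction (trans (sym image-k′) (hasImageOneTo-< w k<k′ image-k)) λ ()
... | tri> _ _ k′<k = contradiction (trans (sym image-k) (hasImageOneTo-< w k′<k image-k′)) λ ()

hasImageOneTo≡covering : ∀ {k m} w → k ≤ m → hasImageOneTo k w ≡ covering m (inOneTo k) (inOneTo k) w
hasImageOneTo≡covering {k} {m} w k≤m = cong (all (inOneTo k) w ∧_) (begin
  all (λ j → elem j w) (oneTo k)
    ≡⟨ all-applyUpTo _ suc k ⟩
  ⋀[ i < k ] elem (suc i) w
    ≡⟨ ⋀-cong k (λ i i<k → cong (λ b → not b ∨ elem (suc i) w) (≤⇒≤ᵇ≡true i<k)) ⟨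
  ⋀[ i < k ] (not (inOneTo k (suc i)) ∨ elem (suc i) w)
    ≡⟨ ⋀-extend (λ i → not (inOneTo k (suc i)) ∨ elem (suc i) w) k≤m
                (λ i k≤i → cong (λ b → not b ∨ elem (suc i) w) (>⇒≤ᵇ≡false (s≤s k≤i))) ⟩
  ⋀[ i < m ] (not (inOneTo k (suc i)) ∨ elem (suc i) w)
    ≡⟨ all-applyUpTo _ suc m ⟨
  covers m (inOneTo k) w ∎)

card-inOneTo : ∀ {k m} → k ≤ m → card m (inOneTo k) ≡ k
card-inOneTo {k} {m} k≤m = begin
  card m (inOneTo k)              ≡⟨ ∑-extend _ k≤m (λ i k≤i → cong ⟦_⟧ (>⇒≤ᵇ≡false (s≤s k≤i))) ⟨
  ∑[ i < k ] ⟦ inOneTo k (suc i) ⟧ ≡⟨ ∑-cong k (λ i i<k → cong ⟦_⟧ (≤⇒≤ᵇ≡true i<k)) ⟩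
  ∑[ i < k ] 1                    ≡⟨ ∑-const 1 k ⟩
  k * 1                           ≡⟨ *-identityʳ k ⟩
  k                               ∎

cay≡fubini : ∀ n → cay n ≡ fubini n
cay≡fubini n = begin
  cay n
    ≡⟨ count-words-cong n n (λ w len → trans (cong (λ l → any (λ k → hasImageOneTo k w) (upTo (suc l))) len)
                                             (sym (∧-identityʳ _))) ⟩
  count (λ w → any (λ k → hasImageOneTo k w) (upTo (suc n)) ∧ true) (words n n)
    ≡⟨ count-any-disjoint hasImageOneTo (λ _ → true) (suc n) (words n n) hasImageOneTo-unique ⟩
  ∑[ k < suc n ] count (λ w → hasImageOneTo k w ∧ true) (words n n)
    ≡⟨ ∑-cong (suc n) (λ k k<1+n → begin
         count (λ w → hasImageOneTo k w ∧ true) (words n n)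
           ≡⟨ count-cong (words n n) (λ w → trans (∧-identityʳ _) (hasImageOneTo≡covering w (s≤s⁻¹ k<1+n))) ⟩
         count (covering n (inOneTo k) (inOneTo k)) (words n n)
           ≡⟨ count-onto n n (inOneTo k) ⟩
         coverings n 0 (card n (inOneTo k))
           ≡⟨ cong (coverings n 0) (card-inOneTo (s≤s⁻¹ k<1+n)) ⟩
         coverings n 0 k ∎) ⟩
  fubini n ∎

prim-suc : ∀ n → prim (suc n) ≡ ∑[ K < suc n ] suc K * coverings n 0 K
prim-suc n = begin
  prim (suc n)
    ≡⟨ count-words-cong m m primitive-of-length ⟩
  count (λ w → any (λ k → hasImageOneTo k w) (upTo (suc m)) ∧ noAdjEq w) (words m m)
    ≡⟨ count-any-disjoint hasImageOneTo noAdjEq (suc m) (words m m) hasImageOneTo-unique ⟩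
  ∑[ k < suc m ] count (λ w → hasImageOneTo k w ∧ noAdjEq w) (words m m)
    ≡⟨ ∑-cong (suc m) (λ k k<1+m → begin
         count (λ w → hasImageOneTo k w ∧ noAdjEq w) (words m m)
           ≡⟨ count-cong (words m m) (λ w → cong (_∧ noAdjEq w) (hasImageOneTo≡covering w (s≤s⁻¹ k<1+m))) ⟩
         count (λ w → covering m (inOneTo k) (inOneTo k) w ∧ noAdjEq w) (words m m)
           ≡⟨ count-onto-noAdjEq n m (inOneTo k) ⟩
         card m (inOneTo k) * coverings n 0 (pred (card m (inOneTo k)))
           ≡⟨ cong (λ c → c * coverings n 0 (pred c)) (card-inOneTo (s≤s⁻¹ k<1+m)) ⟩
         k * coverings n 0 (pred k) ∎) ⟩
  ∑[ k < suc m ] k * coverings n 0 (pred k)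
    ≡⟨ ∑-unfoldˡ _ m ⟩
  ∑[ K < suc n ] suc K * coverings n 0 K ∎
  where
  m = suc n
  primitive-of-length : ∀ w → length w ≡ m → isPrim w ≡ (any (λ k → hasImageOneTo k w) (upTo (suc m)) ∧ noAdjEq w)
  primitive-of-length (x ∷ w) len =
    cong (λ l → any (λ k → hasImageOneTo k (x ∷ w)) (upTo (suc l)) ∧ noAdjEq (x ∷ w)) len

theorem7p2 : (n : ℕ) → prim (suc n) ≡ caySqCount n
theorem7p2 n = begin
  prim (suc n)                           ≡⟨ prim-suc n ⟩
  ∑[ K < suc n ] suc K * coverings n 0 K ≡⟨ fubini-⋆-fubini n ⟨
  (fubini ⋆ fubini) n                    ≡⟨ ⋆-cong n (λ k _ → sym (cay≡fubini k)) (λ k _ → sym (cay≡fubini k)) ⟩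
  (cay ⋆ cay) n                          ≡⟨ sum-applyUpTo _ (λ k → k) (suc n) ⟨
  caySqCount n                           ∎
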